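{- Let $Q$ be a positive integer, let $i\in\mathbb{Z}$, and let $k\ge 3$ be an integer. Then \[ \nu_k(\gamma_i)=\nu_2(\gamma_{i+k-2})\,\nu_{k-1}(\gamma_i)-\nu_{k-2}(\gamma_i). \]
   Context: For $Q\in\mathbb{N}$, the Farey fractions of order $Q$ are $\mathcal{F}_Q=\{a/q\in\mathbb{Q}: 1\le q\le Q,\ 0<a\le q,\ \gcd(a,q)=1\}$. Write $\mathcal{F}_Q=\{\gamma_1,\ldots,\gamma_{N(Q)}\}$ with $1/Q=\gamma_1<\gamma_2<\cdots<\gamma_{N(Q)}=1$, and extend to all $i\in\mathbb{Z}$ by $\gamma_{i+N(Q)}=\gamma_i+1$. Write $\gamma_i=p_i/q_i$ in lowest terms with $q_i>0$. For a positive integer $k$, the $k$-index of $\gamma_i$ is $\nu_k(\gamma_i)=p_{i+k-1}q_{i-1}-p_{i-1}q_{i+k-1}$ (relative to $Q$). -}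

module Defs where

open import Data.Nat as ℕ using (ℕ; zero; suc; NonZero; _<ᵇ_)
open import Data.Integer as ℤ using (ℤ; +_; _+_; _*_; _-_)
open import Data.Integer.DivMod using (_/ℕ_; _%ℕ_)
open import Data.Nat.Coprimality using (Coprime; coprime?)
open import Data.Bool using (if_then_else_)
open import Data.List using (List; []; _∷_; concatMap; map; filter; length; applyUpTo)
open import Data.Product using (_×_; _,_; proj₁; proj₂)

-- A fraction a/q is represented by the pair (a , q) of naturals.
Frac : Set
Frac = ℕ × ℕ

-- all pairs (a , q) with 1 ≤ q ≤ Q, 1 ≤ a ≤ q
candidates : ℕ → List Frac
candidates Q = concatMap (λ q → applyUpTo (λ a → (suc a , suc q)) (suc q)) (applyUpTo (λ q → q) Q)

fareySet : ℕ → List Frac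
fareySet Q = filter (λ x → coprime? (proj₁ x) (proj₂ x)) (candidates Q)

_<F_ : Frac → Frac → _
(a , q) <F (b , r) = (a ℕ.* r) <ᵇ (b ℕ.* q)

insert : Frac → List Frac → List Frac
insert x [] = x ∷ []
insert x (y ∷ ys) = if x <F y then x ∷ y ∷ ys else y ∷ insert x ys

sort : List Frac → List Frac
sort [] = []
sort (x ∷ xs) = insert x (sort xs)

-- F_Q as the increasing list γ_1 < γ_2 < ... < γ_{N(Q)}
farey : ℕ → List Frac
farey Q = sort (fareySet Q)

N : ℕ → ℕ
N Q = length (farey Q)

-- 0-based lookup with a default (only the in-range case is ever used)
nth : List Frac → ℕ → Frac
nth [] _ = (0 , 1)
nth (x ∷ xs) zero = x
nth (x ∷ xs) (suc n) = nth xs n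

-- γ_i = p_i / q_i for i ∈ ℤ, using γ_{i+N} = γ_i + 1:
-- write i - 1 = m*N + r with 0 ≤ r < N; then γ_i = γ_{r+1} + m.
-- (The case N = 0 never occurs for Q ≥ 1.)
pq : ℕ → ℤ → ℤ × ℤ
pq Q i with N Q
... | zero = (+ 0 , + 1)
... | suc n with nth (farey Q) ((i - + 1) %ℕ suc n)
...   | (a , q) = (+ a + ((i - + 1) /ℕ suc n) * + q , + q)

p : ℕ → ℤ → ℤ
p Q i = proj₁ (pq Q i)

q : ℕ → ℤ → ℤ
q Q i = proj₂ (pq Q i)

ν : ℕ → ℕ → ℤ → ℤ
ν Q k i = p Q (i + + k - + 1) * q Q (i - + 1) - p Q (i - + 1) * q Q (i + + k - + 1)

module Submission where

-- The three-term recurrence for Farey k-indices,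
--   ν_k(γ_i) = ν_2(γ_{i+k-2}) ν_{k-1}(γ_i) - ν_{k-2}(γ_i),
-- is an instance of a Plücker relation between 2×2 determinants.  Writing
-- det(u, w) = u₁ w₂ - w₁ u₂, one has ν_k(γ_i) = det(γ_{i+k-1}, γ_{i-1}), and the
-- identity det(A,D) det(B,C) = det(A,C) det(B,D) - det(A,B) det(C,D) applied to
-- A, B, C = γ_{j+2}, γ_{j+1}, γ_j and D = γ_{i-1} gives the recurrence as soon as
-- det(γ_{j+1}, γ_j) = 1 for every j.

open import Defs
open import Data.Nat using (ℕ; _≤_; _∸_)
open import Data.Bool using (true; false; T)
open import Data.Unit using (tt)
open import Data.List using (List; []; _∷_; length; applyUpTo)
open import Data.List.Membership.Propositional using (_∈_; find; lose)
open import Data.List.Relation.Unary.Any using (here; there)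
open import Data.List.Relation.Unary.All as All using (All; []; _∷_)
open import Data.List.Relation.Unary.AllPairs using (AllPairs; []; _∷_)
open import Data.Product using (_×_; _,_; proj₁; proj₂; Σ-syntax)
open import Data.Sum using (_⊎_; inj₁; inj₂)
open import Data.Empty using (⊥-elim)
open import Relation.Nullary using (¬_)
open import Relation.Binary using (tri<; tri≈; tri>)
open import Relation.Binary.PropositionalEquality

module FareySequence where

  open import Data.Nat using (zero; suc; _+_; _*_; _<_; z≤n; s≤s; z<s; NonZero; >-nonZero)
  open import Data.Nat.Properties
  open import Data.Nat.DivMod using (_/_; _%_; m≡m%n+[m/n]*n; m%n≡m∸m/n*n; m%n<n; m/n*n≤m)
  open import Data.Nat.Divisibility using (_∣_; divides; ∣-antisym; ∣1⇒≡1; ∣m+n∣m⇒∣n; ∣m⇒∣m*n; ∣n⇒∣m*n)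
  open import Data.Nat.Coprimality as Coprimality
    using (Coprime; coprime?; coprime-divisor; coprime-Bézout; 1-coprimeTo)
  open import Data.Nat.GCD using (module Bézout)
  open import Data.Nat.Tactic.RingSolver using (solve-∀)
  open import Data.List.Membership.Propositional.Properties
    using (∈-filter⁺; ∈-filter⁻; ∈-applyUpTo⁺; ∈-applyUpTo⁻; ∈-concatMap⁺; ∈-concatMap⁻)
  import Data.List.Relation.Unary.All.Properties as All
  import Data.List.Relation.Unary.AllPairs.Properties as AllPairs
  open import Data.List.Relation.Binary.Permutation.Propositional
    using (_↭_; prep; swap; ↭-refl; ↭-sym; ↭-trans)
  open import Data.List.Relation.Binary.Permutation.Propositional.Properties
    using (∈-resp-↭; All-resp-↭)

  _≺_ : Frac → Frac → Set
  (a , c) ≺ (b , r) = a * r < b * c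

  ≺-irrefl : ∀ x → ¬ x ≺ x
  ≺-irrefl x = <-irrefl refl

  ≺-asym : ∀ x y → x ≺ y → ¬ y ≺ x
  ≺-asym x y = <-asym

  -- Transitivity needs the outer denominators positive, so that they can be
  -- multiplied in (the middle one is cancelled, and is forced to be positive).
  ≺-trans : ∀ x y z → 1 ≤ proj₂ x → 1 ≤ proj₂ z → x ≺ y → y ≺ z → x ≺ z
  ≺-trans (a , c) (b , r) (e , s) 1≤c 1≤s a/c≺b/r b/r≺e/s =
    *-cancelʳ-< r (a * s) (e * c) (begin-strict
      a * s * r   ≡⟨ swap-last a s r ⟩
      a * r * s   <⟨ *-monoˡ-< s {{>-nonZero 1≤s}} a/c≺b/r ⟩
      b * c * s   ≡⟨ swap-last b c s ⟩
      b * s * c   <⟨ *-monoˡ-< c {{>-nonZero 1≤c}} b/r≺e/s ⟩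
      e * r * c   ≡⟨ swap-last e r c ⟩
      e * c * r   ∎)
    where
      open ≤-Reasoning
      swap-last : ∀ u v w → u * v * w ≡ u * w * v
      swap-last u v w = trans (*-assoc u v w) (trans (cong (u *_) (*-comm v w)) (sym (*-assoc u w v)))

  Reduced : Frac → Set
  Reduced (a , c) = Coprime a c × 1 ≤ c

  reduced-injective : ∀ x y → Reduced x → Reduced y → proj₁ x * proj₂ y ≡ proj₁ y * proj₂ x → x ≡ y
  reduced-injective (a , c) (b , r) (a⊥c , 1≤c) (b⊥r , _) ar≡bc = cong₂ _,_ a≡b c≡r
    where
      c≡r : c ≡ r
      c≡r = ∣-antisym (coprime-divisor (Coprimality.sym a⊥c) (divides b ar≡bc))
                      (coprime-divisor (Coprimality.sym b⊥r) (divides a (sym ar≡bc)))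
      a≡b : a ≡ b
      a≡b = *-cancelʳ-≡ a b c {{>-nonZero 1≤c}} (subst (λ t → a * t ≡ b * c) (sym c≡r) ar≡bc)

  ≺-connex : ∀ x y → Reduced x → Reduced y → x ≢ y → x ≺ y ⊎ y ≺ x
  ≺-connex x y rx ry x≢y with <-cmp (proj₁ x * proj₂ y) (proj₁ y * proj₂ x)
  ... | tri< x≺y _ _ = inj₁ x≺y
  ... | tri≈ _ same _ = ⊥-elim (x≢y (reduced-injective x y rx ry same))
  ... | tri> _ _ y≺x = inj₂ y≺x

  ≺-trans-All : ∀ x y zs → Reduced x → All Reduced zs → x ≺ y → All (y ≺_) zs → All (x ≺_) zs
  ≺-trans-All x y [] _ _ _ _ = []
  ≺-trans-All x y (z ∷ zs) rx (rz ∷ rzs) x≺y (y≺z ∷ y≺zs) =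
    ≺-trans x y z (proj₂ rx) (proj₂ rz) x≺y y≺z ∷ ≺-trans-All x y zs rx rzs x≺y y≺zs

  <F⇒≺ : ∀ x y → (x <F y) ≡ true → x ≺ y
  <F⇒≺ x y eq = <ᵇ⇒< (proj₁ x * proj₂ y) (proj₁ y * proj₂ x) (subst T (sym eq) tt)

  ¬<F⇒¬≺ : ∀ x y → (x <F y) ≡ false → ¬ x ≺ y
  ¬<F⇒¬≺ x y eq x≺y = subst T eq (<⇒<ᵇ x≺y)

  insert-↭ : ∀ x ys → insert x ys ↭ x ∷ ys
  insert-↭ x [] = ↭-refl
  insert-↭ x (y ∷ ys) with x <F y
  ... | true = ↭-refl
  ... | false = ↭-trans (prep y (insert-↭ x ys)) (swap y x ↭-refl)

  sort-↭ : ∀ xs → sort xs ↭ xs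
  sort-↭ [] = ↭-refl
  sort-↭ (x ∷ xs) = ↭-trans (insert-↭ x (sort xs)) (prep x (sort-↭ xs))

  insert-sorted : ∀ x ys → Reduced x → All Reduced ys → All (x ≢_) ys →
    AllPairs _≺_ ys → AllPairs _≺_ (insert x ys)
  insert-sorted x [] _ _ _ _ = [] ∷ []
  insert-sorted x (y ∷ ys) rx (ry ∷ rys) (x≢y ∷ x≢ys) (y≺ys ∷ sorted) with x <F y in eq
  ... | true = (x≺y ∷ ≺-trans-All x y ys rx rys x≺y y≺ys) ∷ y≺ys ∷ sorted
    where
      x≺y : x ≺ y
      x≺y = <F⇒≺ x y eq
  ... | false = All-resp-↭ (↭-sym (insert-↭ x ys)) (y≺x ∷ y≺ys) ∷ insert-sorted x ys rx rys x≢ys sorted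
    where
      y≺x : y ≺ x
      y≺x with ≺-connex x y rx ry x≢y
      ... | inj₁ x≺y = ⊥-elim (¬<F⇒¬≺ x y eq x≺y)
      ... | inj₂ y≺x = y≺x

  sort-sorted : ∀ xs → All Reduced xs → AllPairs _≢_ xs → AllPairs _≺_ (sort xs)
  sort-sorted [] _ _ = []
  sort-sorted (x ∷ xs) (rx ∷ rxs) (x≢xs ∷ distinct) =
    insert-sorted x (sort xs) rx (All-resp-↭ (↭-sym (sort-↭ xs)) rxs)
      (All-resp-↭ (↭-sym (sort-↭ xs)) x≢xs) (sort-sorted xs rxs distinct)

  record FareyFrac (Q : ℕ) (x : Frac) : Set where
    constructor fareyFrac
    field
      coprime : Coprime (proj₁ x) (proj₂ x)
      den-pos : 1 ≤ proj₂ x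
      den≤Q   : proj₂ x ≤ Q
      num-pos : 1 ≤ proj₁ x
      num≤den : proj₁ x ≤ proj₂ x

    reduced : Reduced x
    reduced = coprime , den-pos

  column : ℕ → List Frac
  column q = applyUpTo (λ a → (suc a , suc q)) (suc q)

  candidates-sound : ∀ Q a c → (a , c) ∈ candidates Q → 1 ≤ c × c ≤ Q × 1 ≤ a × a ≤ c
  candidates-sound Q a c a/c∈ with find (∈-concatMap⁻ column {xs = applyUpTo (λ q → q) Q} a/c∈)
  ... | q , q∈ , a/c∈column with ∈-applyUpTo⁻ (λ q → q) q∈ | ∈-applyUpTo⁻ (λ a → (suc a , suc q)) a/c∈column
  ... | _ , q<Q , refl | _ , a<q , refl = s≤s z≤n , q<Q , s≤s z≤n , a<q

  candidates-complete : ∀ Q a c → 1 ≤ c → c ≤ Q → 1 ≤ a → a ≤ c → (a , c) ∈ candidates Q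
  candidates-complete Q (suc a) (suc c) _ c≤Q _ a≤c =
    ∈-concatMap⁺ column {xs = applyUpTo (λ q → q) Q}
      (lose (∈-applyUpTo⁺ (λ q → q) c≤Q) (∈-applyUpTo⁺ (λ a → (suc a , suc c)) a≤c))

  -- No candidate is listed twice: within a column numerators differ, across
  -- columns denominators differ.
  candidates-distinct : ∀ Q → AllPairs _≢_ (candidates Q)
  candidates-distinct Q =
    AllPairs.concat⁺ (All.map⁺ (All.applyUpTo⁺₂ (λ q → q) Q within))
                     (AllPairs.map⁺ (AllPairs.applyUpTo⁺₁ (λ q → q) Q across))
    where
      within : ∀ q → AllPairs _≢_ (column q)
      within q = AllPairs.applyUpTo⁺₁ (λ a → (suc a , suc q)) (suc q) λ i<j _ same → <⇒≢ i<j (suc-injective (cong proj₁ same))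
      across : ∀ {i j} → i < j → j < Q → All (λ x → All (x ≢_) (column j)) (column i)
      across {i} {j} i<j _ = All.applyUpTo⁺₂ (λ a → (suc a , suc i)) (suc i) λ _ →
        All.applyUpTo⁺₂ (λ b → (suc b , suc j)) (suc j) λ _ same →
        <⇒≢ i<j (suc-injective (cong proj₂ same))

  fareySet-sound : ∀ Q x → x ∈ fareySet Q → FareyFrac Q x
  fareySet-sound Q (a , c) x∈ with ∈-filter⁻ (λ x → coprime? (proj₁ x) (proj₂ x)) {xs = candidates Q} x∈
  ... | x∈candidates , a⊥c with candidates-sound Q a c x∈candidates
  ... | 1≤c , c≤Q , 1≤a , a≤c = fareyFrac a⊥c 1≤c c≤Q 1≤a a≤c

  farey-sound : ∀ Q x → x ∈ farey Q → FareyFrac Q x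
  farey-sound Q x x∈ = fareySet-sound Q x (∈-resp-↭ (sort-↭ (fareySet Q)) x∈)

  farey-complete : ∀ Q x → FareyFrac Q x → x ∈ farey Q
  farey-complete Q (a , c) (fareyFrac a⊥c 1≤c c≤Q 1≤a a≤c) =
    ∈-resp-↭ (↭-sym (sort-↭ (fareySet Q)))
      (∈-filter⁺ (λ x → coprime? (proj₁ x) (proj₂ x)) (candidates-complete Q a c 1≤c c≤Q 1≤a a≤c) a⊥c)

  farey-sorted : ∀ Q → AllPairs _≺_ (farey Q)
  farey-sorted Q = sort-sorted (fareySet Q)
    (All.tabulate λ {x} x∈ → FareyFrac.reduced (fareySet-sound Q x x∈))
    (AllPairs.filter⁺ (λ x → coprime? (proj₁ x) (proj₂ x)) (candidates-distinct Q))

  nth-∈ : ∀ xs k → k < length xs → nth xs k ∈ xs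
  nth-∈ (x ∷ xs) zero _ = here refl
  nth-∈ (x ∷ xs) (suc k) (s≤s k<n) = there (nth-∈ xs k k<n)

  ∈-nth : ∀ xs {z} → z ∈ xs → Σ[ k ∈ ℕ ] (k < length xs × nth xs k ≡ z)
  ∈-nth (x ∷ xs) (here refl) = zero , s≤s z≤n , refl
  ∈-nth (x ∷ xs) (there z∈) with ∈-nth xs z∈
  ... | k , k<n , eq = suc k , s≤s k<n , eq

  sorted-nth : ∀ {R : Frac → Frac → Set} xs → AllPairs R xs →
    ∀ i j → i < j → j < length xs → R (nth xs i) (nth xs j)
  sorted-nth (x ∷ xs) (x<xs ∷ _) zero (suc j) _ (s≤s j<n) = All.lookup x<xs (nth-∈ xs j j<n)
  sorted-nth (x ∷ xs) (_ ∷ sorted) (suc i) (suc j) (s≤s i<j) (s≤s j<n) = sorted-nth xs sorted i j i<j j<n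

  least-is-first : ∀ {R : Frac → Frac → Set} xs {z} → AllPairs R xs → z ∈ xs →
    (∀ w → w ∈ xs → ¬ R w z) → nth xs 0 ≡ z
  least-is-first xs sorted z∈ least with ∈-nth xs z∈
  ... | zero , _ , eq = eq
  ... | suc k , k<n , refl = ⊥-elim (least (nth xs 0) (nth-∈ xs 0 (<-trans z<s k<n))
                                          (sorted-nth xs sorted 0 (suc k) z<s k<n))

  greatest-is-last : ∀ {R : Frac → Frac → Set} xs {z} n → AllPairs R xs → z ∈ xs →
    (∀ w → w ∈ xs → ¬ R z w) → length xs ≡ suc n → nth xs n ≡ z
  greatest-is-last xs n sorted z∈ greatest len≡1+n with ∈-nth xs z∈
  ... | k , k<len , refl with m≤n⇒m<n∨m≡n (≤-pred (subst (k <_) len≡1+n k<len))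
  ...   | inj₂ refl = refl
  ...   | inj₁ k<n = ⊥-elim (greatest (nth xs n) (nth-∈ xs n n<len) (sorted-nth xs sorted k n k<n n<len))
    where
      n<len : n < length xs
      n<len = subst (n <_) (sym len≡1+n) (n<1+n n)

  farey-first : ∀ Q → 1 ≤ Q → nth (farey Q) 0 ≡ (1 , Q)
  farey-first Q 1≤Q = least-is-first (farey Q) (farey-sorted Q)
    (farey-complete Q (1 , Q) (fareyFrac (1-coprimeTo Q) 1≤Q ≤-refl ≤-refl 1≤Q)) least
    where
      least : ∀ w → w ∈ farey Q → ¬ w ≺ (1 , Q)
      least (a , c) w∈ w≺1/Q = <⇒≱ w≺1/Q (begin
        1 * c ≡⟨ *-identityˡ c ⟩
        c     ≤⟨ FareyFrac.den≤Q (farey-sound Q (a , c) w∈) ⟩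
        Q     ≤⟨ m≤n*m Q a {{>-nonZero (FareyFrac.num-pos (farey-sound Q (a , c) w∈))}} ⟩
        a * Q ∎)
        where open ≤-Reasoning

  one∈farey : ∀ Q → 1 ≤ Q → (1 , 1) ∈ farey Q
  one∈farey Q 1≤Q = farey-complete Q (1 , 1) (fareyFrac (1-coprimeTo 1) ≤-refl 1≤Q ≤-refl ≤-refl)

  farey-last : ∀ Q → 1 ≤ Q → ∀ n → N Q ≡ suc n → nth (farey Q) n ≡ (1 , 1)
  farey-last Q 1≤Q n N≡n+1 = greatest-is-last (farey Q) n (farey-sorted Q) (one∈farey Q 1≤Q) greatest N≡n+1
    where
      greatest : ∀ w → w ∈ farey Q → ¬ (1 , 1) ≺ w
      greatest (a , c) w∈ 1≺w = <⇒≱ 1≺w (begin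
        a * 1 ≡⟨ *-identityʳ a ⟩
        a     ≤⟨ FareyFrac.num≤den (farey-sound Q (a , c) w∈) ⟩
        c     ≡⟨ *-identityˡ c ⟨
        1 * c ∎)
        where open ≤-Reasoning

  farey-nonempty : ∀ Q → 1 ≤ Q → 1 ≤ N Q
  farey-nonempty Q 1≤Q with ∈-nth (farey Q) (one∈farey Q 1≤Q)
  ... | k , k<N , _ = <-≤-trans z<s k<N

  record Solution (a c : ℕ) : Set where
    constructor solution
    field
      x y : ℕ
      eq  : x * c ≡ 1 + a * y

  bezout : ∀ {a c} → Coprime a c → 1 ≤ c → Solution a c
  bezout {a} {suc c} a⊥c _ with coprime-Bézout a⊥c
  ... | Bézout.+- x y eq = solution (1 + c * y) (c * x) (begin
        (1 + c * y) * suc c      ≡⟨ expand c y ⟩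
        1 + c * (1 + y * suc c)  ≡⟨ cong (λ t → 1 + c * t) eq ⟩
        1 + c * (x * a)          ≡⟨ rearrange c x a ⟩
        1 + a * (c * x)          ∎)
    where
      open ≡-Reasoning
      expand : ∀ c y → (1 + c * y) * suc c ≡ 1 + c * (1 + y * suc c)
      expand = solve-∀
      rearrange : ∀ c x a → 1 + c * (x * a) ≡ 1 + a * (c * x)
      rearrange = solve-∀
  ... | Bézout.-+ x y eq = solution y x (trans (sym eq) (cong (1 +_) (*-comm x a)))

  shift-up : ∀ {a c} t → Solution a c → Solution a c
  shift-up {a} {c} t (solution x y eq) = solution (x + t * a) (y + t * c) (begin
    (x + t * a) * c       ≡⟨ *-distribʳ-+ c x (t * a) ⟩
    x * c + t * a * c     ≡⟨ cong (_+ t * a * c) eq ⟩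
    1 + a * y + t * a * c ≡⟨ collect a y t c ⟩
    1 + a * (y + t * c)   ∎)
    where
      open ≡-Reasoning
      collect : ∀ a y t c → 1 + a * y + t * a * c ≡ 1 + a * (y + t * c)
      collect = solve-∀

  shift-down : ∀ {a c} t (s : Solution a c) → t * c ≤ Solution.y s → Solution a c
  shift-down {a} {c} t (solution x y eq) tc≤y = solution (x ∸ t * a) (y ∸ t * c) (begin
    (x ∸ t * a) * c            ≡⟨ *-distribʳ-∸ c x (t * a) ⟩
    x * c ∸ t * a * c          ≡⟨ cong₂ _∸_ eq (reassociate t a c) ⟩
    (1 + a * y) ∸ a * (t * c)  ≡⟨ +-∸-assoc 1 (*-monoʳ-≤ a tc≤y) ⟩
    1 + (a * y ∸ a * (t * c))  ≡⟨ cong (1 +_) (*-distribˡ-∸ a y (t * c)) ⟨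
    1 + a * (y ∸ t * c)        ∎)
    where
      open ≡-Reasoning
      reassociate : ∀ t a c → t * a * c ≡ a * (t * c)
      reassociate = solve-∀

  -- For coprime a, c with 0 < c ≤ Q there is a solution with Q - c < y ≤ Q:
  -- reduce y modulo c, then add the largest multiple of c that keeps y ≤ Q.
  window : ∀ {a c} Q → Coprime a c → 1 ≤ c → c ≤ Q →
    Σ[ s ∈ Solution a c ] (Solution.y s ≤ Q × Q < Solution.y s + c)
  window {a} {c} Q a⊥c 1≤c c≤Q = shift-up t s₀ , below , above
    where
      instance
        c≢0 : NonZero c
        c≢0 = >-nonZero 1≤c
      s : Solution a c
      s = bezout a⊥c 1≤c
      s₀ : Solution a c
      s₀ = shift-down (Solution.y s / c) s (m/n*n≤m (Solution.y s) c)
      y₀ : ℕ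
      y₀ = Solution.y s₀
      y₀≤Q : y₀ ≤ Q
      y₀≤Q = <⇒≤ (<-≤-trans (subst (_< c) (m%n≡m∸m/n*n (Solution.y s) c) (m%n<n (Solution.y s) c)) c≤Q)
      t : ℕ
      t = (Q ∸ y₀) / c
      below : y₀ + t * c ≤ Q
      below = ≤-trans (+-monoʳ-≤ y₀ (m/n*n≤m (Q ∸ y₀) c)) (≤-reflexive (m+[n∸m]≡n y₀≤Q))
      above : Q < y₀ + t * c + c
      above = begin-strict
        Q                          ≡⟨ m+[n∸m]≡n y₀≤Q ⟨
        y₀ + (Q ∸ y₀)              ≡⟨ cong (y₀ +_) (m≡m%n+[m/n]*n (Q ∸ y₀) c) ⟩
        y₀ + ((Q ∸ y₀) % c + t * c) <⟨ +-monoʳ-< y₀ (+-monoˡ-< (t * c) (m%n<n (Q ∸ y₀) c)) ⟩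
        y₀ + (c + t * c)           ≡⟨ reorder y₀ c t ⟩
        y₀ + t * c + c             ∎
        where
          open ≤-Reasoning
          reorder : ∀ y c t → y + (c + t * c) ≡ y + t * c + c
          reorder = solve-∀

  window-fraction : ∀ {Q a c} → FareyFrac Q (a , c) → a < c →
    Σ[ (x , y) ∈ Frac ] (FareyFrac Q (x , y) × x * c ≡ 1 + a * y × Q < y + c)
  window-fraction {Q} {a} {c} (fareyFrac a⊥c 1≤c c≤Q _ _) a<c with window Q a⊥c 1≤c c≤Q
  ... | solution _ zero _ , _ , Q<c = ⊥-elim (<⇒≱ Q<c c≤Q)
  ... | solution zero (suc _) () , _
  ... | solution x@(suc _) y@(suc _) eq , y≤Q , Q<y+c =
        (x , y) , fareyFrac x⊥y z<s y≤Q z<s x≤y , eq , Q<y+c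
    where
      x⊥y : Coprime x y
      x⊥y {d} (d∣x , d∣y) = ∣1⇒≡1 (∣m+n∣m⇒∣n (subst (d ∣_) (trans eq (+-comm 1 (a * y))) (∣m⇒∣m*n c d∣x))
                                          (∣n⇒∣m*n a d∣y))
      x≤y : x ≤ y
      x≤y = *-cancelʳ-≤ x y c {{>-nonZero 1≤c}} (begin
        x * c      ≡⟨ eq ⟩
        1 + a * y  ≤⟨ +-monoˡ-≤ (a * y) z<s ⟩
        suc a * y  ≤⟨ *-monoˡ-≤ y a<c ⟩
        c * y      ≡⟨ *-comm c y ⟩
        y * c      ∎)
        where open ≤-Reasoning

  -- With D₁ = b c - a r and D₂ = x r - b y, the identity
  -- r (x c - a y) = y (b c - a r) + c (x r - b y) reads r = D₁ y + D₂ c.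
  decomposition : ∀ {a c b r x y D₁ D₂} → x * c ≡ 1 + a * y →
    a * r + D₁ ≡ b * c → b * y + D₂ ≡ x * r → r ≡ D₁ * y + D₂ * c
  decomposition {a} {c} {b} {r} {x} {y} {D₁} {D₂} eq e₁ e₂ = +-cancelˡ-≡ (a * r * y) _ _ (begin
    a * r * y + r              ≡⟨ step₁ a r y ⟩
    r * (1 + a * y)            ≡⟨ cong (r *_) eq ⟨
    r * (x * c)                ≡⟨ step₂ r x c ⟩
    x * r * c                  ≡⟨ cong (_* c) e₂ ⟨
    (b * y + D₂) * c           ≡⟨ step₃ b y D₂ c ⟩
    b * c * y + D₂ * c         ≡⟨ cong (λ t → t * y + D₂ * c) e₁ ⟨
    (a * r + D₁) * y + D₂ * c  ≡⟨ step₄ a r D₁ y D₂ c ⟩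
    a * r * y + (D₁ * y + D₂ * c) ∎)
    where
      open ≡-Reasoning
      step₁ : ∀ a r y → a * r * y + r ≡ r * (1 + a * y)
      step₁ = solve-∀
      step₂ : ∀ r x c → r * (x * c) ≡ x * r * c
      step₂ = solve-∀
      step₃ : ∀ b y D₂ c → (b * y + D₂) * c ≡ b * c * y + D₂ * c
      step₃ = solve-∀
      step₄ : ∀ a r D₁ y D₂ c → (a * r + D₁) * y + D₂ * c ≡ a * r * y + (D₁ * y + D₂ * c)
      step₄ = solve-∀

  -- If r = D₁ y + D₂ c with r ≤ Q < y + c, then D₂ = 0, so r = D₁ y and b = x D₁;
  -- as gcd(b, r) = 1 this forces D₁ = 1.
  gap-is-one : ∀ {Q b r x y c D₁} D₂ → Coprime b r → r ≤ Q → Q < y + c → 1 ≤ D₁ → 1 ≤ y →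
    r ≡ D₁ * y + D₂ * c → b * y + D₂ ≡ x * r → D₁ ≡ 1
  gap-is-one {Q} {r = r} {y = y} {c} {D₁} (suc D₂) _ r≤Q Q<y+c 1≤D₁ _ r≡ _ =
    ⊥-elim (<⇒≱ Q<y+c (begin
      y + c                    ≤⟨ +-mono-≤ (m≤n*m y D₁ {{>-nonZero 1≤D₁}}) (m≤m+n c (D₂ * c)) ⟩
      D₁ * y + suc D₂ * c      ≡⟨ r≡ ⟨
      r                        ≤⟨ r≤Q ⟩
      Q                        ∎))
    where open ≤-Reasoning
  gap-is-one {b = b} {r} {x} {y} {D₁ = D₁} zero b⊥r _ _ _ 1≤y r≡ by≡xr =
    b⊥r (divides x b≡xD₁ , divides y (trans r≡D₁y (*-comm D₁ y)))
    where
      open ≡-Reasoning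
      r≡D₁y : r ≡ D₁ * y
      r≡D₁y = trans r≡ (+-identityʳ (D₁ * y))
      b≡xD₁ : b ≡ x * D₁
      b≡xD₁ = *-cancelʳ-≡ b (x * D₁) y {{>-nonZero 1≤y}} (begin
        b * y         ≡⟨ +-identityʳ (b * y) ⟨
        b * y + 0     ≡⟨ by≡xr ⟩
        x * r         ≡⟨ cong (x *_) r≡D₁y ⟩
        x * (D₁ * y)  ≡⟨ *-assoc x D₁ y ⟨
        x * D₁ * y    ∎)

  ≺-proper : ∀ {a c b r} → (a , c) ≺ (b , r) → b ≤ r → a < c
  ≺-proper {a} {c} {b} {r} a/c≺b/r b≤r =
    *-cancelʳ-< r a c (<-≤-trans a/c≺b/r (≤-trans (*-monoˡ-≤ c b≤r) (≤-reflexive (*-comm r c))))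

  Adjacent : Frac → Frac → Set
  Adjacent (a , c) (b , r) = b * c ≡ 1 + a * r

  farey-neighbours : ∀ {Q a c b r} → FareyFrac Q (a , c) → FareyFrac Q (b , r) → (a , c) ≺ (b , r) →
    (∀ z → FareyFrac Q z → (a , c) ≺ z → ¬ z ≺ (b , r)) → Adjacent (a , c) (b , r)
  farey-neighbours {a = a} {c} {b} {r} fa fb a/c≺b/r nothing-between
    with window-fraction fa (≺-proper a/c≺b/r (FareyFrac.num≤den fb))
  ... | (x , y) , fxy , eq , Q<y+c = begin
      b * c         ≡⟨ ar+D₁≡bc ⟨
      a * r + D₁    ≡⟨ cong (a * r +_) D₁≡1 ⟩
      a * r + 1     ≡⟨ +-comm (a * r) 1 ⟩
      1 + a * r     ∎
    where
      open ≡-Reasoning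
      -- x/y lies to the right of a/c, hence not strictly left of b/r
      by≤xr : b * y ≤ x * r
      by≤xr = ≮⇒≥ (nothing-between (x , y) fxy (subst (a * y <_) (sym eq) (n<1+n (a * y))))
      D₁ D₂ : ℕ
      D₁ = b * c ∸ a * r
      D₂ = x * r ∸ b * y
      ar+D₁≡bc : a * r + D₁ ≡ b * c
      ar+D₁≡bc = m+[n∸m]≡n (<⇒≤ a/c≺b/r)
      by+D₂≡xr : b * y + D₂ ≡ x * r
      by+D₂≡xr = m+[n∸m]≡n by≤xr
      D₁≡1 : D₁ ≡ 1
      D₁≡1 = gap-is-one {x = x} {y = y} {c = c} D₂ (FareyFrac.coprime fb) (FareyFrac.den≤Q fb) Q<y+c
        (m<n⇒0<n∸m a/c≺b/r) (FareyFrac.den-pos fxy) (decomposition {a} {c} {b} {r} {x} {y} eq ar+D₁≡bc by+D₂≡xr) by+D₂≡xr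

  farey-adjacent : ∀ Q j → suc j < N Q → Adjacent (nth (farey Q) j) (nth (farey Q) (suc j))
  farey-adjacent Q j j+1<N = farey-neighbours (at j (<-trans (n<1+n j) j+1<N)) (at (suc j) j+1<N)
    (sorted j (suc j) (n<1+n j) j+1<N) nothing-between
    where
      L : List Frac
      L = farey Q
      at : ∀ k → k < N Q → FareyFrac Q (nth L k)
      at k k<N = farey-sound Q (nth L k) (nth-∈ L k k<N)
      sorted : ∀ i k → i < k → k < N Q → nth L i ≺ nth L k
      sorted = sorted-nth L (farey-sorted Q)
      nothing-between : ∀ z → FareyFrac Q z → nth L j ≺ z → ¬ z ≺ nth L (suc j)
      nothing-between z fz left right with ∈-nth L (farey-complete Q z fz)
      ... | k , k<N , refl with <-cmp k j
      ...   | tri< k<j _ _ = ≺-asym (nth L j) (nth L k) left (sorted k j k<j (<-trans (n<1+n j) j+1<N))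
      ...   | tri≈ _ refl _ = ≺-irrefl (nth L j) left
      ...   | tri> _ _ j<k with m≤n⇒m<n∨m≡n j<k
      ...     | inj₁ j+1<k = ≺-asym (nth L k) (nth L (suc j)) right (sorted (suc j) k j+1<k k<N)
      ...     | inj₂ refl = ≺-irrefl (nth L (suc j)) right

open FareySequence using (Adjacent; farey-adjacent; farey-first; farey-last; farey-nonempty)

open import Data.Integer using (ℤ; +_; _+_; _*_; _-_)
import Data.Integer as ℤ
import Data.Integer.Properties as ℤₚ
import Data.Nat as ℕ
import Data.Nat.Properties as ℕₚ
open import Data.Integer.DivMod using (_/ℕ_; _%ℕ_; a≡a%ℕn+[a/ℕn]*n; n%ℕd<d)
open import Data.Integer.Tactic.RingSolver using (solve-∀)

det : ℤ × ℤ → ℤ × ℤ → ℤ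
det (P , R) (P′ , R′) = P * R′ - P′ * R

translate : ℤ → Frac → ℤ × ℤ
translate m (a , c) = (+ a + m * + c , + c)

cancel : ∀ x y → x + y - y ≡ x
cancel = solve-∀

translation-invariance : ∀ a b c r m → (b + m * r) * c - (a + m * c) * r ≡ b * c - a * r
translation-invariance = solve-∀

wrap-around : ∀ m q → (+ 1 + (m + + 1) * q) * + 1 - (+ 1 + m * + 1) * q ≡ + 1
wrap-around = solve-∀

remainder-dominates : ∀ d r r′ (m m′ : ℤ) → r ℕ.< d → m ℤ.< m′ → + r + m * + d ℤ.< + r′ + m′ * + d
remainder-dominates d r r′ m m′ r<d m<m′ = ℤₚ.<-≤-trans (ℤₚ.+-monoˡ-< (m * + d) (ℤ.+<+ r<d))
  (ℤₚ.≤-trans (ℤₚ.≤-reflexive (sym (ℤₚ.suc-* m (+ d))))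
  (ℤₚ.≤-trans (ℤₚ.*-monoʳ-≤-nonNeg (+ d) (ℤₚ.i<j⇒suc[i]≤j m<m′)) (ℤₚ.i≤j+i _ (+ r′))))

division-unique : ∀ d r r′ (m m′ : ℤ) → r ℕ.< d → r′ ℕ.< d →
  + r + m * + d ≡ + r′ + m′ * + d → r ≡ r′ × m ≡ m′
division-unique d r r′ m m′ r<d r′<d same with ℤₚ.<-cmp m m′
... | tri< m<m′ _ _ = ⊥-elim (ℤₚ.<-irrefl same (remainder-dominates d r r′ m m′ r<d m<m′))
... | tri> _ _ m′<m = ⊥-elim (ℤₚ.<-irrefl (sym same) (remainder-dominates d r′ r m′ m r′<d m′<m))
... | tri≈ _ refl _ = ℤₚ.+-injective (begin
      + r                       ≡⟨ cancel (+ r) (m * + d) ⟨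
      + r + m * + d - m * + d   ≡⟨ cong (_- m * + d) same ⟩
      + r′ + m * + d - m * + d  ≡⟨ cancel (+ r′) (m * + d) ⟩
      + r′                      ∎) , refl
  where open ≡-Reasoning

pq-translate : ∀ Q i r m → r ℕ.< N Q → i - + 1 ≡ + r + m * + N Q → pq Q i ≡ translate m (nth (farey Q) r)
pq-translate Q i r m r<N i-1≡ with N Q
... | ℕ.zero = ⊥-elim (ℕₚ.n≮0 r<N)
... | ℕ.suc n with division-unique (ℕ.suc n) ((i - + 1) %ℕ ℕ.suc n) r ((i - + 1) /ℕ ℕ.suc n) m (n%ℕd<d (i - + 1) (ℕ.suc n))
                   r<N (trans (sym (a≡a%ℕn+[a/ℕn]*n (i - + 1) (ℕ.suc n))) i-1≡)
...   | refl , refl = refl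

det-adjacent : ∀ m x y → Adjacent x y → det (translate m y) (translate m x) ≡ + 1
det-adjacent m (a , c) (b , r) bc≡1+ar = begin
  (+ b + m * + r) * + c - (+ a + m * + c) * + r ≡⟨ translation-invariance (+ a) (+ b) (+ c) (+ r) m ⟩
  + b * + c - + a * + r                        ≡⟨ cong₂ _-_ (ℤₚ.pos-* b c) (ℤₚ.pos-* a r) ⟨
  + (b ℕ.* c) - + (a ℕ.* r)                    ≡⟨ cong (λ t → + t - + (a ℕ.* r)) bc≡1+ar ⟩
  + (1 ℕ.+ a ℕ.* r) - + (a ℕ.* r)              ≡⟨ cong (_- + (a ℕ.* r)) (ℤₚ.pos-+ 1 (a ℕ.* r)) ⟩
  + 1 + + (a ℕ.* r) - + (a ℕ.* r)              ≡⟨ cancel (+ 1) (+ (a ℕ.* r)) ⟩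
  + 1                                          ∎
  where open ≡-Reasoning

-- Index bookkeeping for j ↦ j + 1: if j - 1 = r + m n then j = (r + 1) + m n + 1;
-- when r + 1 = n this is 0 + (m + 1) n + 1, the start of the next period.
next-position : ∀ j r m n → j - + 1 ≡ + r + m * + n → j + + 1 - + 1 ≡ + ℕ.suc r + m * + n
next-position j r m n j-1≡ = begin
  j + + 1 - + 1        ≡⟨ step j ⟩
  j - + 1 + + 1        ≡⟨ cong (_+ + 1) j-1≡ ⟩
  + r + m * + n + + 1  ≡⟨ reorder (+ r) (m * + n) ⟩
  + 1 + + r + m * + n  ≡⟨ cong (_+ m * + n) (ℤₚ.pos-+ 1 r) ⟨
  + ℕ.suc r + m * + n  ∎
  where
    open ≡-Reasoning
    step : ∀ j → j + + 1 - + 1 ≡ j - + 1 + + 1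
    step = solve-∀
    reorder : ∀ r k → r + k + + 1 ≡ + 1 + r + k
    reorder = solve-∀

roll-over : ∀ n m → + n + m * + n ≡ + 0 + (m + + 1) * + n
roll-over n m = identity (+ n) m
  where
    identity : ∀ n m → n + m * n ≡ + 0 + (m + + 1) * n
    identity = solve-∀

-- Consecutive terms γ_j, γ_{j+1} of the periodic Farey sequence have determinant 1:
-- either both are translates of neighbours in F_Q by the same m, or
-- γ_j = 1/1 + m and γ_{j+1} = 1/Q + (m + 1).
det-consecutive : ∀ Q → 1 ≤ Q → ∀ j → det (pq Q (j + + 1)) (pq Q j) ≡ + 1
det-consecutive Q 1≤Q j = by-position (ℕₚ.m≤n⇒m<n∨m≡n r<N)
  where
    instance
      N≢0 : ℕ.NonZero (N Q)
      N≢0 = ℕ.>-nonZero (farey-nonempty Q 1≤Q)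
    r : ℕ
    r = (j - + 1) %ℕ N Q
    m : ℤ
    m = (j - + 1) /ℕ N Q
    r<N : r ℕ.< N Q
    r<N = n%ℕd<d (j - + 1) (N Q)
    position : j - + 1 ≡ + r + m * + N Q
    position = a≡a%ℕn+[a/ℕn]*n (j - + 1) (N Q)
    γⱼ : pq Q j ≡ translate m (nth (farey Q) r)
    γⱼ = pq-translate Q j r m r<N position
    by-position : ℕ.suc r ℕ.< N Q ⊎ ℕ.suc r ≡ N Q → det (pq Q (j + + 1)) (pq Q j) ≡ + 1
    by-position (inj₁ r+1<N) = begin
      det (pq Q (j + + 1)) (pq Q j)
        ≡⟨ cong₂ det (pq-translate Q (j + + 1) (ℕ.suc r) m r+1<N (next-position j r m (N Q) position)) γⱼ ⟩
      det (translate m (nth (farey Q) (ℕ.suc r))) (translate m (nth (farey Q) r))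
        ≡⟨ det-adjacent m _ _ (farey-adjacent Q r r+1<N) ⟩
      + 1 ∎
      where open ≡-Reasoning
    by-position (inj₂ r+1≡N) = begin
      det (pq Q (j + + 1)) (pq Q j)
        ≡⟨ cong₂ det (pq-translate Q (j + + 1) 0 (m + + 1) (farey-nonempty Q 1≤Q) next-period) γⱼ ⟩
      det (translate (m + + 1) (nth (farey Q) 0)) (translate m (nth (farey Q) r))
        ≡⟨ cong₂ (λ first last → det (translate (m + + 1) first) (translate m last))
                 (farey-first Q 1≤Q) (farey-last Q 1≤Q r (sym r+1≡N)) ⟩
      det (translate (m + + 1) (1 , Q)) (translate m (1 , 1))
        ≡⟨ wrap-around m (+ Q) ⟩
      + 1 ∎
      where
        open ≡-Reasoning
        next-period : j + + 1 - + 1 ≡ + 0 + (m + + 1) * + N Q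
        next-period = trans (next-position j r m (N Q) position)
                            (trans (cong (λ t → + t + m * + N Q) r+1≡N) (roll-over (N Q) m))

plücker : ∀ A B C D → det A D * det B C ≡ det A C * det B D - det A B * det C D
plücker (a₁ , a₂) (b₁ , b₂) (c₁ , c₂) (d₁ , d₂) = identity a₁ a₂ b₁ b₂ c₁ c₂ d₁ d₂
  where
    identity : ∀ a₁ a₂ b₁ b₂ c₁ c₂ d₁ d₂ →
      (a₁ * d₂ - d₁ * a₂) * (b₁ * c₂ - c₁ * b₂)
        ≡ (a₁ * c₂ - c₁ * a₂) * (b₁ * d₂ - d₁ * b₂) - (a₁ * b₂ - b₁ * a₂) * (c₁ * d₂ - d₁ * c₂)
    identity = solve-∀

three-term : (v : ℤ → ℤ × ℤ) → (∀ j → det (v (j + + 1)) (v j) ≡ + 1) → ∀ j d →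
  det (v (j + + 2)) (v d) ≡ det (v (j + + 2)) (v j) * det (v (j + + 1)) (v d) - det (v j) (v d)
three-term v unimodular j d = begin
  det A D                                  ≡⟨ ℤₚ.*-identityʳ (det A D) ⟨
  det A D * + 1                            ≡⟨ cong (det A D *_) (unimodular j) ⟨
  det A D * det B C                        ≡⟨ plücker A B C D ⟩
  det A C * det B D - det A B * det C D    ≡⟨ cong (λ t → det A C * det B D - t * det C D) A∧B≡1 ⟩
  det A C * det B D - + 1 * det C D        ≡⟨ cong (det A C * det B D -_) (ℤₚ.*-identityˡ (det C D)) ⟩
  det A C * det B D - det C D              ∎
  where
    open ≡-Reasoning
    A B C D : ℤ × ℤ
    A = v (j + + 2)
    B = v (j + + 1)
    C = v j
    D = v d
    two-steps : ∀ j → j + + 1 + + 1 ≡ j + + 2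
    two-steps = solve-∀
    A∧B≡1 : det A B ≡ + 1
    A∧B≡1 = trans (cong (λ t → det (v t) B) (sym (two-steps j))) (unimodular (j + + 1))

ν-as-det : ∀ Q k i u w → i + + k - + 1 ≡ u → i - + 1 ≡ w → ν Q k i ≡ det (pq Q u) (pq Q w)
ν-as-det Q k i u w refl refl = refl

pos-∸ : ∀ {m n} → n ≤ m → + (m ∸ n) ≡ + m - + n
pos-∸ {m} {n} n≤m = trans (sym (ℤₚ.⊖-≥ n≤m)) (sym (ℤₚ.m-n≡m⊖n m n))

module RecurrenceIndices (Q : ℕ) (i : ℤ) (k : ℕ) (3≤k : 3 ≤ k) where

  γ : ℤ → ℤ × ℤ
  γ = pq Q

  j d : ℤ
  j = i + + k - + 3
  d = i - + 1

  ν-k : ν Q k i ≡ det (γ (j + + 2)) (γ d)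
  ν-k = ν-as-det Q k i _ _ (shift i (+ k)) refl
    where
      shift : ∀ i K → i + K - + 1 ≡ i + K - + 3 + + 2
      shift = solve-∀

  ν-2 : ν Q 2 (i + + k - + 2) ≡ det (γ (j + + 2)) (γ j)
  ν-2 = ν-as-det Q 2 (i + + k - + 2) _ _ (shift₁ i (+ k)) (shift₂ i (+ k))
    where
      shift₁ : ∀ i K → i + K - + 2 + + 2 - + 1 ≡ i + K - + 3 + + 2
      shift₁ = solve-∀
      shift₂ : ∀ i K → i + K - + 2 - + 1 ≡ i + K - + 3
      shift₂ = solve-∀

  ν-k-1 : ν Q (k ∸ 1) i ≡ det (γ (j + + 1)) (γ d)
  ν-k-1 = ν-as-det Q (k ∸ 1) i _ _
    (trans (cong (λ t → i + t - + 1) (pos-∸ (ℕₚ.≤-trans (ℕ.s≤s ℕ.z≤n) 3≤k))) (shift i (+ k))) refl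
    where
      shift : ∀ i K → i + (K - + 1) - + 1 ≡ i + K - + 3 + + 1
      shift = solve-∀

  ν-k-2 : ν Q (k ∸ 2) i ≡ det (γ j) (γ d)
  ν-k-2 = ν-as-det Q (k ∸ 2) i _ _
    (trans (cong (λ t → i + t - + 1) (pos-∸ (ℕₚ.≤-trans (ℕ.s≤s (ℕ.s≤s ℕ.z≤n)) 3≤k))) (shift i (+ k))) refl
    where
      shift : ∀ i K → i + (K - + 2) - + 1 ≡ i + K - + 3
      shift = solve-∀

lemma2 : (Q : ℕ) → 1 ≤ Q → (i : ℤ) → (k : ℕ) → 3 ≤ k →
    ν Q k i ≡ ν Q 2 (i + + k - + 2) * ν Q (k ∸ 1) i - ν Q (k ∸ 2) i
lemma2 Q 1≤Q i k 3≤k = begin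
  ν Q k i
    ≡⟨ ν-k ⟩
  det (γ (j + + 2)) (γ d)
    ≡⟨ three-term γ (det-consecutive Q 1≤Q) j d ⟩
  det (γ (j + + 2)) (γ j) * det (γ (j + + 1)) (γ d) - det (γ j) (γ d)
    ≡⟨ cong₂ (λ s t → s * t - det (γ j) (γ d)) ν-2 ν-k-1 ⟨
  ν Q 2 (i + + k - + 2) * ν Q (k ∸ 1) i - det (γ j) (γ d)
    ≡⟨ cong (ν Q 2 (i + + k - + 2) * ν Q (k ∸ 1) i -_) ν-k-2 ⟨
  ν Q 2 (i + + k - + 2) * ν Q (k ∸ 1) i - ν Q (k ∸ 2) i
    ∎
  where
    open ≡-Reasoning
    open RecurrenceIndices Q i k 3≤k
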